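{- Let $m,n\ge2$ with $n$ even, and let $A$ be an $m\times n$ matrix. Applying to $A$ the sequence of rotations $C_1 R^2 C_1^{m-1} R\,(C_1 R C_1^{m-1} R)^{\frac n2-1}$ swaps the elements in positions $R[1]$ and $R[n]$ and leaves every other element in its original position.
   Context: Rows and columns are numbered from $1$. $R$ denotes the first row and $C_1$ the first column; $R[j]$ is the position in row $1$, column $j$. In a sequence of rotations, the symbol $R$ denotes one unit rightward rotation of the first row (the element in column $j$ moves to column $j+1$ for $j<n$, and the element in column $n$ moves to column $1$), and $C_1$ denotes one unit downward rotation of the first column (the element in row $i$ moves to row $i+1$ for $i<m$, and the element in row $m$ moves to row $1$). A superscript $k\ge0$ denotes $k$ consecutive repetitions, juxtaposition denotes concatenation, and sequences are applied from left to right. -}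

module Defs where

open import Data.Nat using (ℕ; zero; suc)
open import Data.Fin using (Fin; zero; suc; fromℕ; inject₁)
open import Data.List using (List; []; _∷_; _++_; foldl)
open import Relation.Binary.PropositionalEquality using (_≡_)
open import Relation.Nullary using (Dec; yes; no)
open import Data.Fin using (_≟_)

-- An m × n matrix with entries in A; rows and columns are indexed by Fin,
-- so row 1 / column 1 of the paper is index zero.
Matrix : Set → ℕ → ℕ → Set
Matrix A m n = Fin m → Fin n → A

cpred : ∀ {k} → Fin (suc k) → Fin (suc k)
cpred {k} zero    = fromℕ k
cpred     (suc i) = inject₁ i

-- R: rotate the first row one unit to the right
-- (entry in column j moves to column j+1, last column moves to column 1).
rotR : ∀ {A m n} → Matrix A (suc m) (suc n) → Matrix A (suc m) (suc n)
rotR M zero    j = M zero (cpred j)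
rotR M (suc i) j = M (suc i) j

-- C₁: rotate the first column one unit down
-- (entry in row i moves to row i+1, last row moves to row 1).
rotC : ∀ {A m n} → Matrix A (suc m) (suc n) → Matrix A (suc m) (suc n)
rotC M i zero    = M (cpred i) zero
rotC M i (suc j) = M i (suc j)

data Rot : Set where
  R C₁ : Rot

rep : ℕ → List Rot → List Rot
rep zero    w = []
rep (suc k) w = w ++ rep k w

applyRot : ∀ {A m n} → Rot → Matrix A (suc m) (suc n) → Matrix A (suc m) (suc n)
applyRot R  = rotR
applyRot C₁ = rotC

applySeq : ∀ {A m n} → List Rot → Matrix A (suc m) (suc n) → Matrix A (suc m) (suc n)
applySeq ws M = foldl (λ N r → applyRot r N) M ws

-- Applying a word w of rotations gives B i j = M (srcSeq w (i , j)) for a map srcSeq w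
-- on positions, so the theorem is a computation with these source maps.  As C₁ has
-- order m, L = C₁ R C₁^(m-1) = C₁ R C₁⁻¹ is a conjugate of R: writing C₁[m] for the
-- position in row m, column 1, it rotates the entries at C₁[m], R[2], …, R[n] one place
-- forward and fixes all others.  The word is L X^(n/2) with X = C₁ R C₁^(m-1) R = L R,
-- and on the n + 1 positions R[1], C₁[m], R[2], …, R[n], in this cyclic order, X moves
-- every entry two places forward, fixing all other positions.  Hence X^(n/2) moves the
-- cycle one place back, which undoes L everywhere except at R[1] and R[n], whose entries
-- end up exchanged.

module Submission where

open import Defs
open import Data.Empty using (⊥-elim)
open import Data.Fin using (Fin; zero; suc; toℕ; inject₁; fromℕ)
open import Data.Fin.Properties using (toℕ-injective; toℕ-inject₁; toℕ-fromℕ; toℕ≤pred[n]; toℕ≤n)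
open import Data.Fin.Relation.Unary.Top using (view; ‵fromℕ; ‵inject₁)
open import Data.List using (List; []; _∷_; _++_)
open import Data.Nat using (ℕ; zero; suc; _+_; _*_; _∸_; _/_; _≤_; s≤s; z≤n; NonZero)
open import Data.Nat.Divisibility using (_∣_; divides)
open import Data.Nat.DivMod using (_%_; m*n/n≡m; %-distribˡ-+; m%n%n≡m%n; [m+n]%n≡m%n; [m+kn]%n≡m%n; m≤n⇒m%n≡m)
open import Data.Nat.Properties using (+-assoc; +-comm; +-suc; +-identityʳ; *-comm; ≤-refl)
open import Data.Product using (_×_; _,_; uncurry; proj₁; proj₂)
open import Function.Base using (_∘′_; id)
import Function.Endo.Propositional
open import Relation.Binary.PropositionalEquality
  using (_≡_; _≢_; refl; sym; trans; cong; cong₂; cong-app; module ≡-Reasoning)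

open module Endo {X : Set} = Function.Endo.Propositional X using (_^_; ^-homo)

^-fixed : ∀ {X : Set} (f : X → X) {x} → f x ≡ x → ∀ k → (f ^ k) x ≡ x
^-fixed f fx≡x zero    = refl
^-fixed f fx≡x (suc k) = trans (cong f (^-fixed f fx≡x k)) fx≡x

^-intertwine : ∀ {X Y : Set} {f : Y → Y} {g : X → Y} {h : X → X} →
               (∀ x → f (g x) ≡ g (h x)) → ∀ k x → (f ^ k) (g x) ≡ g ((h ^ k) x)
^-intertwine         fg≡gh zero    x = refl
^-intertwine {f = f} fg≡gh (suc k) x = trans (cong f (^-intertwine fg≡gh k x)) (fg≡gh _)

^-* : ∀ {X : Set} (f : X → X) m n → (f ^ m) ^ n ≡ f ^ (n * m)
^-* f m zero    = refl
^-* f m (suc n) = trans (cong ((f ^ m) ∘′_) (^-* f m n)) (sym (^-homo f m (n * m)))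

suc[m/n∸1]*n≡m : ∀ {m n} .{{_ : NonZero n}} → n ∣ suc m → suc (suc m / n ∸ 1) * n ≡ suc m
suc[m/n∸1]*n≡m         (divides zero    ())
suc[m/n∸1]*n≡m {m} {n} (divides (suc q) eq) = begin
  suc (suc m / n ∸ 1) * n         ≡⟨ cong (λ x → suc (x / n ∸ 1) * n) eq ⟩
  suc (suc q * n / n ∸ 1) * n     ≡⟨ cong (λ x → suc (x ∸ 1) * n) (m*n/n≡m (suc q) n) ⟩
  suc q * n                       ≡⟨ eq ⟨
  suc m                           ∎
  where open ≡-Reasoning

toℕ-cpred : ∀ {k} (i : Fin (suc k)) → toℕ (cpred i) ≡ (toℕ i + k) % suc k
toℕ-cpred {k} zero    = trans (toℕ-fromℕ k) (sym (m≤n⇒m%n≡m ≤-refl))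
toℕ-cpred {k} (suc i) = begin
  toℕ (inject₁ i)             ≡⟨ toℕ-inject₁ i ⟩
  toℕ i                       ≡⟨ m≤n⇒m%n≡m (toℕ≤n i) ⟨
  toℕ i % suc k               ≡⟨ [m+n]%n≡m%n (toℕ i) (suc k) ⟨
  (toℕ i + suc k) % suc k     ≡⟨ cong (_% suc k) (+-suc (toℕ i) k) ⟩
  suc (toℕ i + k) % suc k     ∎
  where open ≡-Reasoning

toℕ-cpred^ : ∀ {k} s (i : Fin (suc k)) → toℕ ((cpred ^ s) i) ≡ (toℕ i + s * k) % suc k
toℕ-cpred^ {k} zero    i =
  trans (sym (m≤n⇒m%n≡m (toℕ≤pred[n] i))) (cong (_% suc k) (sym (+-identityʳ (toℕ i))))
toℕ-cpred^ {k} (suc s) i = begin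
  toℕ (cpred ((cpred ^ s) i))                ≡⟨ toℕ-cpred ((cpred ^ s) i) ⟩
  (toℕ ((cpred ^ s) i) + k) % suc k          ≡⟨ cong (λ x → (x + k) % suc k) (toℕ-cpred^ s i) ⟩
  ((toℕ i + s * k) % suc k + k) % suc k      ≡⟨ %-absorbˡ-+ (toℕ i + s * k) k ⟩
  (toℕ i + s * k + k) % suc k                ≡⟨ cong (_% suc k) (+-assoc (toℕ i) (s * k) k) ⟩
  (toℕ i + (s * k + k)) % suc k              ≡⟨ cong (λ x → (toℕ i + x) % suc k) (+-comm (s * k) k) ⟩
  (toℕ i + suc s * k) % suc k                ∎
  where
  open ≡-Reasoning
  %-absorbˡ-+ : ∀ a b → (a % suc k + b) % suc k ≡ (a + b) % suc k
  %-absorbˡ-+ a b = begin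
    (a % suc k + b) % suc k                    ≡⟨ %-distribˡ-+ (a % suc k) b (suc k) ⟩
    (a % suc k % suc k + b % suc k) % suc k    ≡⟨ cong (λ x → (x + b % suc k) % suc k) (m%n%n≡m%n a (suc k)) ⟩
    (a % suc k + b % suc k) % suc k            ≡⟨ %-distribˡ-+ a b (suc k) ⟨
    (a + b) % suc k                            ∎

cpred^-period : ∀ k (i : Fin (suc k)) → (cpred ^ suc k) i ≡ i
cpred^-period k i = toℕ-injective (begin
  toℕ ((cpred ^ suc k) i)       ≡⟨ toℕ-cpred^ (suc k) i ⟩
  (toℕ i + suc k * k) % suc k   ≡⟨ cong (λ x → (toℕ i + x) % suc k) (*-comm (suc k) k) ⟩
  (toℕ i + k * suc k) % suc k   ≡⟨ [m+kn]%n≡m%n (toℕ i) k (suc k) ⟩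
  toℕ i % suc k                 ≡⟨ m≤n⇒m%n≡m (toℕ≤pred[n] i) ⟩
  toℕ i                         ∎)
  where open ≡-Reasoning

cpred^k∘cpred : ∀ k (i : Fin (suc k)) → (cpred ^ k) (cpred i) ≡ i
cpred^k∘cpred k i = begin
  (cpred ^ k) (cpred i)    ≡⟨ cong-app (^-homo cpred k 1) i ⟨
  (cpred ^ (k + 1)) i      ≡⟨ cong (λ s → (cpred ^ s) i) (+-comm k 1) ⟩
  (cpred ^ suc k) i        ≡⟨ cpred^-period k i ⟩
  i                        ∎
  where open ≡-Reasoning

cpredTail : ∀ {k} → Fin (suc (suc k)) → Fin (suc (suc k))
cpredTail zero    = zero
cpredTail (suc i) = suc (cpred i)

swap₀₁ : ∀ {k} → Fin (suc (suc k)) → Fin (suc (suc k))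
swap₀₁ zero          = suc zero
swap₀₁ (suc zero)    = zero
swap₀₁ (suc (suc i)) = suc (suc i)

cpred≡cpredTail∘swap₀₁ : ∀ {k} (i : Fin (suc (suc k))) → cpred i ≡ cpredTail (swap₀₁ i)
cpred≡cpredTail∘swap₀₁ zero          = refl
cpred≡cpredTail∘swap₀₁ (suc zero)    = refl
cpred≡cpredTail∘swap₀₁ (suc (suc i)) = refl

XWord : ℕ → List Rot
XWord m = (C₁ ∷ R ∷ []) ++ rep m (C₁ ∷ []) ++ (R ∷ [])

swapWord : ℕ → ℕ → List Rot
swapWord m t = (C₁ ∷ R ∷ R ∷ []) ++ rep m (C₁ ∷ []) ++ (R ∷ []) ++ rep t (XWord m)

Pos : ℕ → ℕ → Set
Pos m n = Fin m × Fin n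

module _ {m n : ℕ} where

  srcR : Pos (suc m) (suc n) → Pos (suc m) (suc n)
  srcR (zero  , j) = zero , cpred j
  srcR (suc i , j) = suc i , j

  srcC₁ : Pos (suc m) (suc n) → Pos (suc m) (suc n)
  srcC₁ (i , zero)  = cpred i , zero
  srcC₁ (i , suc j) = i , suc j

  src : Rot → Pos (suc m) (suc n) → Pos (suc m) (suc n)
  src R  = srcR
  src C₁ = srcC₁

  srcSeq : List Rot → Pos (suc m) (suc n) → Pos (suc m) (suc n)
  srcSeq []       = id
  srcSeq (w ∷ ws) = src w ∘′ srcSeq ws

  applySeq-srcSeq : ∀ {A} ws (M : Matrix A (suc m) (suc n)) i j →
                    applySeq ws M i j ≡ uncurry M (srcSeq ws (i , j))
  applySeq-srcSeq []       M i j = refl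
  applySeq-srcSeq (w ∷ ws) M i j =
    trans (applySeq-srcSeq ws (applyRot w M) i j) (applyRot-src w (srcSeq ws (i , j)))
    where
    applyRot-src : ∀ w p → uncurry (applyRot w M) p ≡ uncurry M (src w p)
    applyRot-src R  (zero  , j) = refl
    applyRot-src R  (suc i , j) = refl
    applyRot-src C₁ (i , zero)  = refl
    applyRot-src C₁ (i , suc j) = refl

  srcSeq-++ : ∀ ws vs → srcSeq (ws ++ vs) ≡ srcSeq ws ∘′ srcSeq vs
  srcSeq-++ []       vs = refl
  srcSeq-++ (w ∷ ws) vs = cong (src w ∘′_) (srcSeq-++ ws vs)

  srcSeq-rep : ∀ k ws → srcSeq (rep k ws) ≡ srcSeq ws ^ k
  srcSeq-rep zero    ws = refl
  srcSeq-rep (suc k) ws = trans (srcSeq-++ ws (rep k ws)) (cong (srcSeq ws ∘′_) (srcSeq-rep k ws))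

  srcC₁^-col₀ : ∀ k i → (srcC₁ ^ k) (i , zero) ≡ ((cpred ^ k) i , zero)
  srcC₁^-col₀ = ^-intertwine {g = _, zero} (λ _ → refl)

  srcC₁^m∘srcC₁ : ∀ p → (srcC₁ ^ m) (srcC₁ p) ≡ p
  srcC₁^m∘srcC₁ (i , zero)  = trans (srcC₁^-col₀ m (cpred i)) (cong (_, zero) (cpred^k∘cpred m i))
  srcC₁^m∘srcC₁ (i , suc j) = ^-fixed srcC₁ refl m

  srcL : Pos (suc m) (suc n) → Pos (suc m) (suc n)
  srcL = srcC₁ ∘′ srcR ∘′ (srcC₁ ^ m)

  srcL∘srcC₁ : ∀ p → srcL (srcC₁ p) ≡ srcC₁ (srcR p)
  srcL∘srcC₁ p = cong (srcC₁ ∘′ srcR) (srcC₁^m∘srcC₁ p)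

  srcL-fixes-interior : ∀ i j → srcL (suc i , suc j) ≡ (suc i , suc j)
  srcL-fixes-interior i j = srcL∘srcC₁ (suc i , suc j)

  srcX : Pos (suc m) (suc n) → Pos (suc m) (suc n)
  srcX = srcL ∘′ srcR

  srcWord : ℕ → Pos (suc m) (suc n) → Pos (suc m) (suc n)
  srcWord t = srcL ∘′ (srcX ^ suc t)

  srcWord-fixes : ∀ t {i j} → srcL (suc i , j) ≡ (suc i , j) → srcWord t (suc i , j) ≡ (suc i , j)
  srcWord-fixes t fixed = trans (cong srcL (^-fixed srcX fixed (suc t))) fixed

  srcSeq-XWord : srcSeq (XWord m) ≡ srcX
  srcSeq-XWord = cong (λ f → srcC₁ ∘′ srcR ∘′ f)
    (trans (srcSeq-++ (rep m (C₁ ∷ [])) (R ∷ [])) (cong (_∘′ srcR) (srcSeq-rep m (C₁ ∷ []))))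

  srcSeq-swapWord : ∀ t p → srcSeq (swapWord m t) p ≡ srcWord t p
  srcSeq-swapWord t p = begin
    srcSeq (swapWord m t) p
      ≡⟨ cong-app (cong (λ f → srcC₁ ∘′ srcR ∘′ srcR ∘′ f) unfold) p ⟩
    srcC₁ (srcR (srcR ((srcC₁ ^ m) (srcR ((srcX ^ t) p)))))
      ≡⟨ srcL∘srcC₁ _ ⟨
    srcWord t p ∎
    where
    open ≡-Reasoning
    unfold : srcSeq (rep m (C₁ ∷ []) ++ R ∷ rep t (XWord m)) ≡ (srcC₁ ^ m) ∘′ srcR ∘′ (srcX ^ t)
    unfold = begin
      srcSeq (rep m (C₁ ∷ []) ++ R ∷ rep t (XWord m))
        ≡⟨ srcSeq-++ (rep m (C₁ ∷ [])) (R ∷ rep t (XWord m)) ⟩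
      srcSeq (rep m (C₁ ∷ [])) ∘′ srcR ∘′ srcSeq (rep t (XWord m))
        ≡⟨ cong₂ (λ f g → f ∘′ srcR ∘′ g) (srcSeq-rep m (C₁ ∷ []))
                 (trans (srcSeq-rep t (XWord m)) (cong (_^ t) srcSeq-XWord)) ⟩
      (srcC₁ ^ m) ∘′ srcR ∘′ (srcX ^ t) ∎

srcL-fixes-column : ∀ {m n} (i : Fin m) → srcL {suc m} {n} (suc (inject₁ i) , zero) ≡ (suc (inject₁ i) , zero)
srcL-fixes-column i = srcL∘srcC₁ (suc (suc i) , zero)

module _ {m n : ℕ} where

  cross : Fin (suc (suc (suc n))) → Pos (suc (suc m)) (suc (suc n))
  cross zero          = zero , zero
  cross (suc zero)    = fromℕ (suc m) , zero
  cross (suc (suc j)) = zero , suc j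

  srcR∘cross : ∀ k → srcR (cross k) ≡ cross (swap₀₁ (cpredTail (swap₀₁ k)))
  srcR∘cross zero                = refl
  srcR∘cross (suc zero)          = refl
  srcR∘cross (suc (suc zero))    = refl
  srcR∘cross (suc (suc (suc j))) = refl

  srcL∘cross : ∀ k → srcL (cross k) ≡ cross (cpredTail k)
  srcL∘cross zero                = srcL∘srcC₁ (suc zero , zero)
  srcL∘cross (suc zero)          = srcL∘srcC₁ (zero , zero)
  srcL∘cross (suc (suc zero))    = srcL∘srcC₁ (zero , suc zero)
  srcL∘cross (suc (suc (suc j))) = srcL∘srcC₁ (zero , suc (suc j))

  srcX∘cross : ∀ k → srcX (cross k) ≡ cross (cpred (cpred k))
  srcX∘cross k = begin
    srcL (srcR (cross k))                                 ≡⟨ cong srcL (srcR∘cross k) ⟩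
    srcL (cross (swap₀₁ (cpredTail (swap₀₁ k))))          ≡⟨ srcL∘cross _ ⟩
    cross (cpredTail (swap₀₁ (cpredTail (swap₀₁ k))))     ≡⟨ cong cross (cpred≡cpredTail∘swap₀₁ _) ⟨
    cross (cpred (cpredTail (swap₀₁ k)))                  ≡⟨ cong (cross ∘′ cpred) (cpred≡cpredTail∘swap₀₁ k) ⟨
    cross (cpred (cpred k))                               ∎
    where open ≡-Reasoning

  srcWord∘cross∘cpred : ∀ t → suc t * 2 ≡ suc (suc n) →
                        ∀ k → srcWord t (cross (cpred k)) ≡ cross (cpredTail k)
  srcWord∘cross∘cpred t half k = begin
    srcL ((srcX ^ suc t) (cross (cpred k)))
      ≡⟨ cong srcL (^-intertwine {f = srcX} {g = cross} {h = cpred ^ 2} srcX∘cross (suc t) (cpred k)) ⟩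
    srcL (cross (((cpred ^ 2) ^ suc t) (cpred k)))
      ≡⟨ cong (λ f → srcL (cross (f (cpred k)))) (^-* cpred 2 (suc t)) ⟩
    srcL (cross ((cpred ^ (suc t * 2)) (cpred k)))
      ≡⟨ cong (λ s → srcL (cross ((cpred ^ s) (cpred k)))) half ⟩
    srcL (cross ((cpred ^ suc (suc n)) (cpred k)))
      ≡⟨ cong (srcL ∘′ cross) (cpred^k∘cpred (suc (suc n)) k) ⟩
    srcL (cross k)
      ≡⟨ srcL∘cross k ⟩
    cross (cpredTail k) ∎
    where open ≡-Reasoning

lemma13 : ∀ {A : Set} (m n : ℕ) → 2 ≤ suc m → 2 ≤ suc n → 2 ∣ suc n →
          (M : Matrix A (suc m) (suc n)) →
          let B = applySeq ((C₁ ∷ R ∷ R ∷ [])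
                             ++ rep m (C₁ ∷ [])
                             ++ (R ∷ [])
                             ++ rep (suc n / 2 ∸ 1) ((C₁ ∷ R ∷ []) ++ rep m (C₁ ∷ []) ++ (R ∷ [])))
                            M
          in (B zero zero ≡ M zero (fromℕ n))
             × (B zero (fromℕ n) ≡ M zero zero)
             × (∀ (i : Fin (suc m)) (j : Fin (suc n)) →
                  (i ≡ zero → (j ≢ zero × j ≢ fromℕ n)) → B i j ≡ M i j)
lemma13 (suc m) (suc n) (s≤s (s≤s z≤n)) (s≤s (s≤s z≤n)) 2∣cols M =
  entry (onCross (suc zero)) , entry (onCross zero) , others
  where
  t = suc (suc n) / 2 ∸ 1
  onCross : ∀ k → srcWord t (cross (cpred k)) ≡ cross (cpredTail k)
  onCross = srcWord∘cross∘cpred t (suc[m/n∸1]*n≡m 2∣cols)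
  entry : ∀ {i j p} → srcWord t (i , j) ≡ p → applySeq (swapWord (suc m) t) M i j ≡ uncurry M p
  entry {i} {j} src≡p = trans (applySeq-srcSeq (swapWord (suc m) t) M i j)
                              (cong (uncurry M) (trans (srcSeq-swapWord t (i , j)) src≡p))
  others : ∀ i j → (i ≡ zero → j ≢ zero × j ≢ fromℕ (suc n)) →
           applySeq (swapWord (suc m) t) M i j ≡ M i j
  others zero    zero    off = ⊥-elim (proj₁ (off refl) refl)
  others zero    (suc j) off with view j
  ... | ‵fromℕ     = ⊥-elim (proj₂ (off refl) refl)
  ... | ‵inject₁ j = entry (onCross (suc (suc (suc j))))
  others (suc i) zero    off with view i
  ... | ‵fromℕ     = entry (onCross (suc (suc zero)))
  ... | ‵inject₁ i = entry (srcWord-fixes t (srcL-fixes-column i))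
  others (suc i) (suc j) off = entry (srcWord-fixes t (srcL-fixes-interior i j))
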